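{- Let $\Sigma$ be an effect signature, $Q$ a complete lattice and $\mathcal{Q}$ a set of modalities on $Q$. If every $q\in\mathcal{Q}$ is leaf-monotone and sequential, then $\mathcal{Q}$ is decomposable.
   Context: Effect signature: a set $\Sigma$ of operation symbols, each with an arity of one of the forms $\alpha^n\to\alpha$ ($n\in\mathbb{N}$), $\mathbb{N}\times\alpha^n\to\alpha$, or $\alpha^{\mathbb{N}}\to\alpha$. For a set $X$, $TX$ is the set of effect trees over $X$: labelled, possibly infinite-depth trees whose nodes are either a leaf labelled $\bot$, a leaf labelled by some $x\in X$, a node labelled $\sigma$ with children $t_1,\dots,t_n$ (for $\sigma:\alpha^n\to\alpha$), a node labelled $\sigma$ with children $t_0,t_1,\dots$ (for $\sigma:\alpha^{\mathbb{N}}\to\alpha$), or a node labelled $\sigma_m$ ($m\in\mathbb{N}$) with children $t_1,\dots,t_n$ (for $\sigma:\mathbb{N}\times\alpha^n\to\alpha$). For $h:X\to Y$, $h^*:TX\to TY$ replaces every non-$\bot$ leaf $x$ by $h(x)$. $\mu:TTX\to TX$ flattens a tree of trees by grafting each leaf tree in place of its leaf. $Q$ is a complete lattice with order $\le$. A modality $q$ is a function $[\![q]\!]:TQ\to Q$; for $h:X\to Q$ and $t\in TX$ write $(t\in q(h)) := [\![q]\!](h^*(t))$. Leaf order on $TQ$: $t\,T(\le)\,r$ iff $r$ is obtained from $t$ by replacing each leaf labelled $a\in Q$ by a leaf labelled some $b\ge a$ ($\bot$ leaves and internal nodes unchanged). $q$ is leaf-monotone if $t\,T(\le)\,r$ implies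 $[\![q]\!](t)\le[\![q]\!](r)$. $q$ is sequential if $[\![q]\!](\mu t)=[\![q]\!]([\![q]\!]^*(t))$ for all $t\in TTQ$. Preorder $\preceq$ on $TQ$: $t\preceq t'$ iff for all $q\in\mathcal{Q}$ and all monotone $h:Q\to Q$, $(t\in q(h))\le(t'\in q(h))$. $H:TQ\to Q$ is in $\mathrm{QBS}$ if $t\preceq t'$ implies $H(t)\le H(t')$. Preorder $\trianglelefteq$ on $TTQ$: $r\trianglelefteq r'$ iff for all $q\in\mathcal{Q}$ and all $H\in\mathrm{QBS}$, $(r\in q(H))\le(r'\in q(H))$. $\mathcal{Q}$ is decomposable if for all $r,r'\in TTQ$, $r\trianglelefteq r'$ implies $\mu r\preceq\mu r'$. -}

module Defs where

open import Level using (0ℓ)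
open import Data.Nat using (ℕ; _<_)
open import Data.List using (List; []; _∷_)
open import Data.Unit using (⊤)
open import Relation.Binary.Bundles using (Poset)
open import Relation.Binary.PropositionalEquality using (_≡_)

data Arity : Set where
  plain : ℕ → Arity     -- α^n → α
  param : ℕ → Arity     -- ℕ × α^n → α
  count : Arity         -- α^ℕ → α

-- Extra node label: the natural number m in σ_m for arities ℕ × α^n → α.
Par : Arity → Set
Par (plain _) = ⊤
Par (param _) = ℕ
Par count     = ⊤

-- Which child indices i : ℕ exist for a node of the given arity
-- (children t_1..t_n are numbered 0..n-1; for α^ℕ → α all i : ℕ).
InPos : Arity → ℕ → Set
InPos (plain n) i = i < n
InPos (param n) i = i < n
InPos count     i = ⊤

record Signature : Set₁ where
  field
    Op    : Set
    arity : Op → Arity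

-- Coinduction (--guardedness) is not available, so a tree is presented
-- by its labelling function on finite addresses (lists of child indices).
-- Only the *valid* addresses (those reaching an actual node) carry
-- meaning; all relations on trees below only look at valid addresses.

module Trees (Sig : Signature) where
  open Signature Sig

  data Shape (X : Set) : Set where
    bot  : Shape X
    leaf : X → Shape X
    op   : (σ : Op) → Par (arity σ) → Shape X

  T : Set → Set
  T X = List ℕ → Shape X

  sub : {X : Set} → T X → ℕ → T X
  sub t i w = t (i ∷ w)

  data Valid {X : Set} : T X → List ℕ → Set where
    root  : ∀ {t} → Valid t []
    child : ∀ {t σ p i w} → t [] ≡ op σ p → InPos (arity σ) i →
            Valid (sub t i) w → Valid t (i ∷ w)

  mapShape : {X Y : Set} → (X → Y) → Shape X → Shape Y
  mapShape h bot      = bot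
  mapShape h (leaf x) = leaf (h x)
  mapShape h (op σ p) = op σ p

  map : {X Y : Set} → (X → Y) → T X → T Y
  map h t w = mapShape h (t w)

  mutual
    μ : {X : Set} → T (T X) → T X
    μ t w = μStep t (t []) w

    μStep : {X : Set} → T (T X) → Shape (T X) → List ℕ → Shape X
    μStep t bot        w       = bot
    μStep t (leaf r)   w       = r w
    μStep t (op σ p)   []      = op σ p
    μStep t (op σ p)   (i ∷ w) = μ (sub t i) w

  data ShapeRel {X Y : Set} (R : X → Y → Set) : Shape X → Shape Y → Set where
    bot  : ShapeRel R bot bot
    leaf : ∀ {a b} → R a b → ShapeRel R (leaf a) (leaf b)
    op   : ∀ σ p → ShapeRel R (op σ p) (op σ p)

  TRel : {X Y : Set} → (X → Y → Set) → T X → T Y → Set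
  TRel R t r = ∀ w → Valid t w → ShapeRel R (t w) (r w)

record CompleteLattice : Set₁ where
  field
    poset : Poset 0ℓ 0ℓ 0ℓ
  open Poset poset public
  field
    ⋁       : (Carrier → Set) → Carrier
    ⋁-upper : ∀ (S : Carrier → Set) x → S x → x ≤ ⋁ S
    ⋁-least : ∀ (S : Carrier → Set) y → (∀ x → S x → x ≤ y) → ⋁ S ≤ y

module Modalities (Sig : Signature) (L : CompleteLattice) where
  open Trees Sig public
  open CompleteLattice L renaming (Carrier to Q)

  -- A modality q is given by its interpretation ⟦q⟧ : T Q → Q.
  Modality : Set
  Modality = T Q → Q

  _∈[_]_ : {X : Set} → T X → Modality → (X → Q) → Q
  t ∈[ q ] h = q (map h t)

  _T≤_ : T Q → T Q → Set
  _T≤_ = TRel _≤_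

  LeafMonotone : Modality → Set
  LeafMonotone q = ∀ t r → t T≤ r → q t ≤ q r

  Sequential : Modality → Set
  Sequential q = ∀ (t : T (T Q)) → q (μ t) ≈ q (map q t)

  Monotone : (Q → Q) → Set
  Monotone h = ∀ {a b} → a ≤ b → h a ≤ h b

  -- A set of modalities 𝒬, presented as a family indexed by I.
  module _ {I : Set} (𝒬 : I → Modality) where

    _⪯_ : T Q → T Q → Set
    t ⪯ t′ = ∀ (i : I) (h : Q → Q) → Monotone h →
             (t ∈[ 𝒬 i ] h) ≤ (t′ ∈[ 𝒬 i ] h)

    QBS : (T Q → Q) → Set
    QBS H = ∀ t t′ → t ⪯ t′ → H t ≤ H t′

    _⊴_ : T (T Q) → T (T Q) → Set
    r ⊴ r′ = ∀ (i : I) (H : T Q → Q) → QBS H →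
             (r ∈[ 𝒬 i ] H) ≤ (r′ ∈[ 𝒬 i ] H)

    Decomposable : Set
    Decomposable = ∀ r r′ → r ⊴ r′ → μ r ⪯ μ r′

-- The map h^* commutes with the flattening μ, and h^* followed by ⟦q⟧^* is (q-membership of h)^*.
-- Hence, for a sequential modality q, membership of μ r in q(h) equals membership of r in q(H)
-- for H t := (t ∈ q(h)); this H is in QBS when h is monotone, so r ⊴ r′ transfers to μ r ⪯ μ r′.
module Submission where

open import Defs
open import Function using (_∘_)
open import Data.List using (List; []; _∷_)
open import Data.Nat using (ℕ)
open import Relation.Binary.PropositionalEquality using (_≡_; refl; sym)
import Relation.Binary.Reasoning.PartialOrder as ≤-Reasoning

module TreeProperties (Sig : Signature) where
  open Trees Sig

  mapShape-∘ : {X Y Z : Set} (g : Y → Z) (f : X → Y) (s : Shape X) →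
               mapShape g (mapShape f s) ≡ mapShape (g ∘ f) s
  mapShape-∘ g f bot      = refl
  mapShape-∘ g f (leaf x) = refl
  mapShape-∘ g f (op σ p) = refl

  map-∘ : {X Y Z : Set} (g : Y → Z) (f : X → Y) (t : T X) (w : List ℕ) →
          map g (map f t) w ≡ map (g ∘ f) t w
  map-∘ g f t w = mapShape-∘ g f (t w)

  mutual
    map-μ : {X Y : Set} (h : X → Y) (r : T (T X)) (w : List ℕ) →
            map h (μ r) w ≡ μ (map (map h) r) w
    map-μ h r w = map-μStep h r (r []) w

    map-μStep : {X Y : Set} (h : X → Y) (r : T (T X)) (s : Shape (T X)) (w : List ℕ) →
                mapShape h (μStep r s w) ≡ μStep (map (map h) r) (mapShape (map h) s) w
    map-μStep h r bot      w       = refl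
    map-μStep h r (leaf t) w       = refl
    map-μStep h r (op σ p) []      = refl
    map-μStep h r (op σ p) (i ∷ w) = map-μ h (sub r i) w

module ModalityProperties (Sig : Signature) (L : CompleteLattice) where
  open Modalities Sig L
  open TreeProperties Sig
  open CompleteLattice L renaming (Carrier to Q; refl to ≤-refl)
  open ≤-Reasoning poset

  ShapeRel-refl : (s : Shape Q) → ShapeRel _≤_ s s
  ShapeRel-refl bot      = bot
  ShapeRel-refl (leaf a) = leaf ≤-refl
  ShapeRel-refl (op σ p) = op σ p

  leafMonotone-≗⇒≤ : {q : Modality} → LeafMonotone q → {t t′ : T Q} →
                     (∀ w → t w ≡ t′ w) → q t ≤ q t′
  leafMonotone-≗⇒≤ {q} mono {t} {t′} t≗t′ = mono t t′ (λ w _ → ShapeRel-≡ (t≗t′ w))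
    where
    ShapeRel-≡ : {s s′ : Shape Q} → s ≡ s′ → ShapeRel _≤_ s s′
    ShapeRel-≡ {s} refl = ShapeRel-refl s

  leafMonotone-≗⇒≈ : {q : Modality} → LeafMonotone q → {t t′ : T Q} →
                     (∀ w → t w ≡ t′ w) → q t ≈ q t′
  leafMonotone-≗⇒≈ mono t≗t′ =
    antisym (leafMonotone-≗⇒≤ mono t≗t′) (leafMonotone-≗⇒≤ mono (sym ∘ t≗t′))

  μ-∈ : {q : Modality} → LeafMonotone q → Sequential q →
        (h : Q → Q) (r : T (T Q)) → (μ r ∈[ q ] h) ≈ (r ∈[ q ] (_∈[ q ] h))
  μ-∈ {q} mono seq h r = Eq.trans (leafMonotone-≗⇒≈ mono (map-μ h r))
                        (Eq.trans (seq (map (map h) r))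
                                  (leafMonotone-≗⇒≈ mono (map-∘ q (map h) r)))

  ∈-QBS : {I : Set} (𝒬 : I → Modality) (i : I) {h : Q → Q} → Monotone h →
          QBS 𝒬 (_∈[ 𝒬 i ] h)
  ∈-QBS 𝒬 i h-mono t t′ t⪯t′ = t⪯t′ i _ h-mono

  decomposable : {I : Set} (𝒬 : I → Modality) →
                 (∀ i → LeafMonotone (𝒬 i)) → (∀ i → Sequential (𝒬 i)) →
                 Decomposable 𝒬
  decomposable 𝒬 mono seq r r′ r⊴r′ i h h-mono = begin
    μ r ∈[ 𝒬 i ] h                 ≈⟨ μ-∈ (mono i) (seq i) h r ⟩
    r ∈[ 𝒬 i ] (_∈[ 𝒬 i ] h)       ≤⟨ r⊴r′ i _ (∈-QBS 𝒬 i h-mono) ⟩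
    r′ ∈[ 𝒬 i ] (_∈[ 𝒬 i ] h)      ≈⟨ Eq.sym (μ-∈ (mono i) (seq i) h r′) ⟩
    μ r′ ∈[ 𝒬 i ] h                ∎

lemma12 : (Sig : Signature) (L : CompleteLattice) →
    let open Modalities Sig L in
    {I : Set} (𝒬 : I → Modality) →
    (∀ i → LeafMonotone (𝒬 i)) →
    (∀ i → Sequential (𝒬 i)) →
    Decomposable 𝒬
lemma12 Sig L = ModalityProperties.decomposable Sig L
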